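{- Let $K$ be a semiring as in the context, let $\{0,1\}\subseteq X\subseteq K$, and let $P\subseteq K^*$ be $\mathsf{NP}_K$-complete under non-arithmetic reductions respecting machine constants. Then $P\cap X^*$ is $\mathsf{NP}_{K,X}$-complete under non-arithmetic reductions.
   Context: A semiring $K=(K,+,\cdot,0,1)$: $(K,+,0)$ commutative monoid, $(K,\cdot,1)$ monoid, two-sided distributivity, $0$ absorbing. Standing assumption: $K$ is commutative, positive ($ab\neq0$ for $a\neq0\neq b$; $a+b=0\Rightarrow a=b=0$) and non-trivial ($0\neq1$). $K$ is ordered if it has a partial order $\le$ with $0\le1$ compatible with $+$ and with multiplication by elements $\ge0$. $\mathrm{BSS}_K$ machines: state space $K^{\mathbb Z}$, written $(\dots,x_{ -1},x_0\,\textbf{.}\,x_1,\dots)$; a finite directed graph with input node $1$, output node $N$, computation nodes replacing a fixed coordinate $x_i$ by $x_j+x_k$, $x_j\cdot x_k$ or a constant $c\in K$ (a machine constant), branch nodes testing $x_1=x_2$ (or $x_1\le x_2$ if $K$ ordered), and shift nodes shifting the state by one position. Input $(x_1,\dots,x_n)$ is placed at coordinates $1..n$, with ones at $-n..-1$ and zeros elsewhere; output $f_M(\bar x)=(x_1,\dots,x_\ell)$ where $\ell$ is the number of consecutive ones at coordinates $-1,-2,\dots$ at the output node. $M$ decides $L$ non-deterministically (on a set $Y\subseteq K^*$ of inputs) if for all $\bar x\in Y$: $\bar x\in L$ iff some guess $\bar x'\in K^*$ gives $f_M(\bar x,\bar x')\neq0$, the pair being placed as $(\dots,0,1^{|\bar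 x'|},0,1^{|\bar x|},0\,\textbf{.}\,\bar x,\bar x',0,\dots)$. $\mathsf{NP}_K$: languages $L\subseteq K^*$ decided non-deterministically on $K^*$ by polynomial-time machines. $\mathsf{NP}_{K,X}$: languages $L\subseteq X^*$ decided non-deterministically on inputs in $X^*$ by a polynomial-time machine using only machine constants in $X$. A machine is non-arithmetic if for every input in $K^*$, whenever an arithmetic computation node is reached, it is a constant assignment or an operation $a\star b$ ($\star\in\{+,\cdot\}$) with at least one operand equal to the neutral element of $\star$. For $L\subseteq K^*$, $L'\subseteq X^*$, $L'\le_m^{\mathsf{PTIME}_{K,X}}L$ means there is $f:X^*\to K^*$ computable in polynomial time by a $\mathrm{BSS}_K$ machine with constants in $X$ with $\bar x\in L'\iff f(\bar x)\in L$ for $\bar x\in X^*$; it is non-arithmetic if $f$ is computed by a non-arithmetic machine. $L\subseteq X^*$ is $\mathsf{NP}_{K,X}$-complete under non-arithmetic reductions if $L\in\mathsf{NP}_{K,X}$ and every $L'\in\mathsf{NP}_{K,X}$ has a non-arithmetic reduction $L'\le_m^{\mathsf{PTIME}_{K,X}}L$. $L\subseteq K^*$ is $\mathsf{NP}_K$-complete under non-arithmetic reductions respecting machine constants if $L\in\mathsf{NP}_K$ is witnessed by a polynomial-time machine using only machine constants $0,1$, and for every $L'\in\mathsf{NP}_K$ and every polynomial-time $\mathrm{BSS}_K$ machine $M$ deciding $L'$ non-deterministically there is a polynomial-time non-arithmetic $\mathrm{BSS}_K$ machine $M'$ using only the machine constants of $M$ together with $0,1$ such that $\bar x\in L'\iff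 f_{M'}(\bar x)\in L$ for all $\bar x\in K^*$. -}

module Defs where

open import Data.Nat using (ℕ; zero; suc; _≤_; _<_; _^_) renaming (_+_ to _+ℕ_; _*_ to _*ℕ_)
open import Data.Nat.Base using (_<ᵇ_; _≡ᵇ_)
open import Data.Integer.Base using (ℤ; +_; -[1+_]; +[1+_])
import Data.Integer.Base as ℤ
open import Data.Integer.Properties using () renaming (_≟_ to _≟ℤ_)
open import Data.Fin using (Fin; zero; suc)
open import Data.List using (List; []; _∷_; _++_; length; map; upTo; lookup)
open import Data.List.Relation.Unary.All using (All)
open import Data.Bool using (Bool; true; false; if_then_else_; _∧_; not)
open import Data.Product using (Σ; Σ-syntax; ∃; ∃-syntax; _×_; _,_)
open import Data.Sum using (_⊎_)
open import Data.Unit using (⊤)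
open import Relation.Nullary using (¬_; does)
open import Relation.Binary.PropositionalEquality using (_≡_; _≢_)
open import Relation.Binary.Structures using (IsPartialOrder)
open import Algebra.Structures using (IsCommutativeSemiring)

record PosSemiring : Set₁ where
  infixl 6 _+_
  infixl 7 _*_
  field
    K   : Set
    _+_ : K → K → K
    _*_ : K → K → K
    0#  : K
    1#  : K
    isCommutativeSemiring : IsCommutativeSemiring _≡_ _+_ _*_ 0# 1#
    positive-* : ∀ a b → a ≢ 0# → b ≢ 0# → a * b ≢ 0#
    positive-+ : ∀ a b → a + b ≡ 0# → (a ≡ 0#) × (b ≡ 0#)
    nontrivial : 0# ≢ 1#

record IsOrdering (S : PosSemiring) (_≤K_ : PosSemiring.K S → PosSemiring.K S → Set) : Set where
  open PosSemiring S
  field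
    isPartialOrder : IsPartialOrder _≡_ _≤K_
    0≤1            : 0# ≤K 1#
    +-mono         : ∀ {a b} c → a ≤K b → (a + c) ≤K (b + c)
    *-mono         : ∀ {a b} c → a ≤K b → 0# ≤K c → (a * c) ≤K (b * c)

data BranchMode (S : PosSemiring) : Set₁ where
  eqTest : BranchMode S
  leTest : (_≤K_ : PosSemiring.K S → PosSemiring.K S → Set) → IsOrdering S _≤K_ → BranchMode S

branchRel : (S : PosSemiring) → BranchMode S → PosSemiring.K S → PosSemiring.K S → Set
branchRel S eqTest = _≡_
branchRel S (leTest _≤K_ _) = _≤K_

module BSS (S : PosSemiring) (T : BranchMode S) where
  open PosSemiring S

  testRel : K → K → Set
  testRel = branchRel S T

  -- Machines: nodes Fin (suc size); node zero is the input node,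
  -- nodes carrying outputI are output nodes.

  data Instr (n : ℕ) : Set where
    addI mulI : (i j k : ℤ) → Fin n → Instr n   -- x_i := x_j ⋆ x_k
    constI    : (i : ℤ) → K → Fin n → Instr n   -- x_i := c
    branchI   : (yes no : Fin n) → Instr n      -- test x_1 vs x_2
    shiftLI shiftRI : Fin n → Instr n
    outputI   : Instr n

  record Machine : Set where
    field
      size : ℕ
      prog : Fin (suc size) → Instr (suc size)
  open Machine public

  State : Set
  State = ℤ → K

  Config : Machine → Set
  Config M = Fin (suc (size M)) × State

  update : State → ℤ → K → State
  update s i v j = if does (j ≟ℤ i) then v else s j

  data Step (M : Machine) : Config M → Config M → Set where
    add : ∀ {ν ν' i j k s} → prog M ν ≡ addI i j k ν' →
          Step M (ν , s) (ν' , update s i (s j + s k))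
    mul : ∀ {ν ν' i j k s} → prog M ν ≡ mulI i j k ν' →
          Step M (ν , s) (ν' , update s i (s j * s k))
    cst : ∀ {ν ν' i c s} → prog M ν ≡ constI i c ν' →
          Step M (ν , s) (ν' , update s i c)
    brYes : ∀ {ν ν₁ ν₂ s} → prog M ν ≡ branchI ν₁ ν₂ →
            testRel (s (+ 1)) (s (+ 2)) → Step M (ν , s) (ν₁ , s)
    brNo  : ∀ {ν ν₁ ν₂ s} → prog M ν ≡ branchI ν₁ ν₂ →
            ¬ testRel (s (+ 1)) (s (+ 2)) → Step M (ν , s) (ν₂ , s)
    shL : ∀ {ν ν' s} → prog M ν ≡ shiftLI ν' →
          Step M (ν , s) (ν' , (λ i → s (i ℤ.+ + 1)))
    shR : ∀ {ν ν' s} → prog M ν ≡ shiftRI ν' →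
          Step M (ν , s) (ν' , (λ i → s (i ℤ.- + 1)))

  data Run (M : Machine) : ℕ → Config M → Config M → Set where
    done : ∀ {c} → Run M 0 c c
    step : ∀ {t c c' c''} → Step M c c' → Run M t c' c'' → Run M (suc t) c c''

  -- Output (x_1,…,x_ℓ), ℓ = number of consecutive ones at -1,-2,…
  OutputOf : State → List K → Set
  OutputOf s w = Σ[ ℓ ∈ ℕ ] ((∀ i → i < ℓ → s -[1+ i ] ≡ 1#) × s -[1+ ℓ ] ≢ 1#
                             × w ≡ map (λ i → s +[1+ i ]) (upTo ℓ))

  -- Initial state for input xs and guess gs:
  -- (…,0,1^{|gs|},0,1^{|xs|},0 . xs,gs,0,…); deterministic input: gs = [].
  nth0 : List K → ℕ → K
  nth0 [] _ = 0#
  nth0 (x ∷ _) zero = x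
  nth0 (_ ∷ xs) (suc n) = nth0 xs n

  initState : List K → List K → State
  initState xs gs (+ zero) = 0#
  initState xs gs +[1+ i ] = nth0 (xs ++ gs) i
  initState xs gs -[1+ j ] =
    if (j <ᵇ length xs) then 1#
    else if (j ≡ᵇ length xs) then 0#
    else if (j <ᵇ suc (length xs +ℕ length gs)) then 1#
    else 0#

  initConfig : (M : Machine) → List K → List K → Config M
  initConfig M xs gs = zero , initState xs gs

  HaltsWithin : (M : Machine) → Config M → ℕ → List K → Set
  HaltsWithin M c t w = Σ[ t' ∈ ℕ ] Σ[ ν ∈ Fin (suc (size M)) ] Σ[ s ∈ State ]
    (t' ≤ t × Run M t' c (ν , s) × prog M ν ≡ outputI × OutputOf s w)

  Halts : (M : Machine) → Config M → List K → Set
  Halts M c w = Σ[ t ∈ ℕ ] HaltsWithin M c t w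

  poly : ℕ → ℕ → ℕ → ℕ
  poly c k n = c *ℕ (n ^ k) +ℕ c

  Language : Set₁
  Language = List K → Set

  NDPolyTime : Machine → Set
  NDPolyTime M = Σ[ c ∈ ℕ ] Σ[ k ∈ ℕ ] ∀ xs gs →
    Σ[ w ∈ List K ] HaltsWithin M (initConfig M xs gs) (poly c k (length xs)) w

  DetPolyTimeOn : Machine → (List K → Set) → Set
  DetPolyTimeOn M D = Σ[ c ∈ ℕ ] Σ[ k ∈ ℕ ] ∀ xs → D xs →
    Σ[ w ∈ List K ] HaltsWithin M (initConfig M xs []) (poly c k (length xs)) w

  NDDecidesOn : Machine → (List K → Set) → Language → Set
  NDDecidesOn M Y L = ∀ xs → Y xs →
    (L xs → Σ[ gs ∈ List K ] Σ[ w ∈ List K ] (Halts M (initConfig M xs gs) w × w ≢ 0# ∷ []))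
    × (Σ[ gs ∈ List K ] Σ[ w ∈ List K ] (Halts M (initConfig M xs gs) w × w ≢ 0# ∷ []) → L xs)

  MachineConst : Machine → K → Set
  MachineConst M c = Σ[ ν ∈ Fin (suc (size M)) ] Σ[ i ∈ ℤ ] Σ[ ν' ∈ Fin (suc (size M)) ]
    (prog M ν ≡ constI i c ν')

  ConstantsIn : Machine → (K → Set) → Set
  ConstantsIn M C = ∀ c → MachineConst M c → C c

  ArithOK : ∀ {n} → Instr n → State → Set
  ArithOK (addI i j k _) s = (s j ≡ 0#) ⊎ (s k ≡ 0#)
  ArithOK (mulI i j k _) s = (s j ≡ 1#) ⊎ (s k ≡ 1#)
  ArithOK _ s = ⊤

  NonArithmetic : Machine → Set
  NonArithmetic M = ∀ xs t ν s → Run M t (initConfig M xs []) (ν , s) → ArithOK (prog M ν) s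

  AllK : List K → Set
  AllK _ = ⊤

  NP-K : Language → Set
  NP-K L = Σ[ M ∈ Machine ] (NDPolyTime M × NDDecidesOn M AllK L)

  NP-KX : (K → Set) → Language → Set
  NP-KX X L = (∀ xs → L xs → All X xs) ×
    (Σ[ M ∈ Machine ] (NDPolyTime M × ConstantsIn M X × NDDecidesOn M (All X) L))

  NonArithReductionX : (K → Set) → Language → Language → Set
  NonArithReductionX X L' L = Σ[ M ∈ Machine ]
    (ConstantsIn M X × NonArithmetic M × DetPolyTimeOn M (All X) ×
     (∀ xs → All X xs → ∀ w → Halts M (initConfig M xs []) w → (L' xs → L w) × (L w → L' xs)))

  NP-KX-CompleteNonArith : (K → Set) → Language → Set₁
  NP-KX-CompleteNonArith X L = NP-KX X L × (∀ L' → NP-KX X L' → NonArithReductionX X L' L)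

  Const01 : K → Set
  Const01 c = (c ≡ 0#) ⊎ (c ≡ 1#)

  NP-K-CompleteRespConst : Language → Set₁
  NP-K-CompleteRespConst L =
    (Σ[ M ∈ Machine ] (NDPolyTime M × ConstantsIn M Const01 × NDDecidesOn M AllK L))
    × (∀ (L' : Language) (M : Machine) → NDPolyTime M → NDDecidesOn M AllK L' →
         Σ[ M' ∈ Machine ] (DetPolyTimeOn M' AllK × NonArithmetic M' ×
           ConstantsIn M' (λ c → MachineConst M c ⊎ Const01 c) ×
           (∀ xs w → Halts M' (initConfig M' xs []) w → (L' xs → L w) × (L w → L' xs))))

{-# OPTIONS --safe #-}
-- A non-arithmetic machine only ever copies entries of its state or writes one of
-- its machine constants: an addition has a zero operand and a multiplication a unit
-- operand. So if the input and all machine constants lie in X ⊇ {0,1}, every state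
-- it reaches, and hence its output, lies in X. Given L' ∈ NP_{K,X} decided by N,
-- completeness of P reduces the language accepted by N over all of K* to P by a
-- non-arithmetic machine whose constants are those of N or 0, 1, hence in X; on X*
-- that language is L', and the reduction lands in P ∩ X*. Membership of P ∩ X* is
-- witnessed by the 0/1-constant machine deciding P.
module Submission where

open import Defs
open import Algebra.Structures using (IsCommutativeSemiring)
open import Data.Bool using (Bool; if_then_else_)
open import Data.Integer.Base using (+_; -[1+_]; +[1+_])
open import Data.Integer.Properties using () renaming (_≟_ to _≟ℤ_)
open import Data.List using (List; []; _∷_; length; upTo)
open import Data.List.Relation.Unary.All using (All; []; _∷_; universal)
open import Data.List.Relation.Unary.All.Properties using (map⁺; ++⁺)
open import Data.Nat using (zero; suc; _<ᵇ_; _≡ᵇ_) renaming (_+_ to _+ℕ_)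
open import Data.Product using (_×_; _,_; proj₁; proj₂; Σ-syntax)
open import Data.Sum using (_⊎_; inj₁; inj₂; [_,_]′)
open import Function using (_∘_; id)
open import Relation.Binary.PropositionalEquality using (_≡_; _≢_; refl; sym; subst)
open import Relation.Nullary using (does)

module _ {S : PosSemiring} {T : BranchMode S} where
  open BSS S T

  Run-snoc : ∀ {M t c c' c''} → Run M t c c' → Step M c' c'' → Run M (suc t) c c''
  Run-snoc done          st' = step st' done
  Run-snoc (step st run) st' = step st (Run-snoc run st')

  Run-invariant : ∀ {M} (Q : Config M → Set) {c₀} → Q c₀ →
    (∀ {t c c'} → Run M t c₀ c → Q c → Step M c c' → Q c') →
    ∀ {t c} → Run M t c₀ c → Q c
  Run-invariant {M} Q {c₀} q₀ preserve = go done q₀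
    where
    go : ∀ {t₀ c t c'} → Run M t₀ c₀ c → Q c → Run M t c c' → Q c'
    go prefix q done          = q
    go prefix q (step st run) = go (Run-snoc prefix st) (preserve prefix q st) run

module _ (S : PosSemiring) (T : BranchMode S) (X : PosSemiring.K S → Set) where
  open PosSemiring S
  open BSS S T
  open IsCommutativeSemiring isCommutativeSemiring
    using (+-identityˡ; +-identityʳ; *-identityˡ; *-identityʳ)

  if-in : ∀ (b : Bool) {u v} → X u → X v → X (if b then u else v)
  if-in Bool.true  xu _  = xu
  if-in Bool.false _  xv = xv

  StateIn : State → Set
  StateIn s = ∀ i → X (s i)

  update-in : ∀ {s v} i → X v → StateIn s → StateIn (update s i v)
  update-in i xv sX j = if-in (does (j ≟ℤ i)) xv (sX j)

  +-in-if-zero : ∀ {a b} → (a ≡ 0#) ⊎ (b ≡ 0#) → X a → X b → X (a + b)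
  +-in-if-zero {b = b} (inj₁ refl) _  xb = subst X (sym (+-identityˡ b)) xb
  +-in-if-zero {a = a} (inj₂ refl) xa _  = subst X (sym (+-identityʳ a)) xa

  *-in-if-one : ∀ {a b} → (a ≡ 1#) ⊎ (b ≡ 1#) → X a → X b → X (a * b)
  *-in-if-one {b = b} (inj₁ refl) _  xb = subst X (sym (*-identityˡ b)) xb
  *-in-if-one {a = a} (inj₂ refl) xa _  = subst X (sym (*-identityʳ a)) xa

  Const01⇒X : X 0# → X 1# → ∀ c → Const01 c → X c
  Const01⇒X x0 _  _ (inj₁ refl) = x0
  Const01⇒X _  x1 _ (inj₂ refl) = x1

  nth0-in : X 0# → ∀ {ys} n → All X ys → X (nth0 ys n)
  nth0-in x0 n       []         = x0
  nth0-in x0 zero    (xy ∷ _)   = xy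
  nth0-in x0 (suc n) (_  ∷ ysX) = nth0-in x0 n ysX

  initState-in : X 0# → X 1# → ∀ {xs gs} → All X xs → All X gs → StateIn (initState xs gs)
  initState-in x0 x1 xsX gsX (+ zero)  = x0
  initState-in x0 x1 xsX gsX +[1+ i ] = nth0-in x0 i (++⁺ xsX gsX)
  initState-in x0 x1 {xs} {gs} _ _ -[1+ j ] =
    if-in (j <ᵇ length xs) x1
      (if-in (j ≡ᵇ length xs) x0 (if-in (j <ᵇ suc (length xs +ℕ length gs)) x1 x0))

  step-in : ∀ {M ν s ν' s'} → ConstantsIn M X → Step M (ν , s) (ν' , s') →
            ArithOK (prog M ν) s → StateIn s → StateIn s'
  step-in {s = s} _ (add {i = i} eq) ok sX =
    update-in i (+-in-if-zero (subst (λ I → ArithOK I s) eq ok) (sX _) (sX _)) sX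
  step-in {s = s} _ (mul {i = i} eq) ok sX =
    update-in i (*-in-if-one (subst (λ I → ArithOK I s) eq ok) (sX _) (sX _)) sX
  step-in {ν = ν} {ν' = ν'} consts (cst {i = i} {c} eq) _ sX =
    update-in i (consts c (ν , i , ν' , eq)) sX
  step-in _ (brYes _ _) _ sX = sX
  step-in _ (brNo _ _)  _ sX = sX
  step-in _ (shL _)     _ sX = sX ∘ _
  step-in _ (shR _)     _ sX = sX ∘ _

  OutputOf-in : ∀ {s w} → StateIn s → OutputOf s w → All X w
  OutputOf-in sX (ℓ , _ , _ , refl) = map⁺ (universal (λ i → sX +[1+ i ]) (upTo ℓ))

  module _ {M : Machine} (x0 : X 0#) (x1 : X 1#) (consts : ConstantsIn M X)
           (nonArith : NonArithmetic M) {xs : List K} (xsX : All X xs) where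

    nonArithmetic-Run-in : ∀ {t c} → Run M t (initConfig M xs []) c → StateIn (proj₂ c)
    nonArithmetic-Run-in = Run-invariant (StateIn ∘ proj₂) (initState-in x0 x1 xsX [])
      (λ {_} {c} prefix sX st → step-in consts st (nonArith xs _ (proj₁ c) (proj₂ c) prefix) sX)

    nonArithmetic-Halts-in : ∀ {w} → Halts M (initConfig M xs []) w → All X w
    nonArithmetic-Halts-in (_ , _ , _ , _ , _ , run , _ , out) =
      OutputOf-in (nonArithmetic-Run-in run) out

  Accepts : Machine → Language
  Accepts N xs = Σ[ gs ∈ List K ] Σ[ w ∈ List K ] (Halts N (initConfig N xs gs) w × w ≢ 0# ∷ [])

  module _ (x0 : X 0#) (x1 : X 1#) {P : Language} where

    restriction-in-NP-KX :
      Σ[ M ∈ Machine ] (NDPolyTime M × ConstantsIn M Const01 × NDDecidesOn M AllK P) →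
      NP-KX X (λ xs → P xs × All X xs)
    restriction-in-NP-KX (M , time , consts01 , decides) =
      (λ _ → proj₂) , M , time , (λ c → Const01⇒X x0 x1 c ∘ consts01 c) ,
      λ xs xsX → proj₁ (decides xs _) ∘ proj₁ , λ acc → proj₂ (decides xs _) acc , xsX

    restriction-NP-KX-hard :
      (∀ (L' : Language) (M : Machine) → NDPolyTime M → NDDecidesOn M AllK L' →
         Σ[ M' ∈ Machine ] (DetPolyTimeOn M' AllK × NonArithmetic M' ×
           ConstantsIn M' (λ c → MachineConst M c ⊎ Const01 c) ×
           (∀ xs w → Halts M' (initConfig M' xs []) w → (L' xs → P w) × (P w → L' xs)))) →
      ∀ L' → NP-KX X L' → NonArithReductionX X L' (λ xs → P xs × All X xs)
    restriction-NP-KX-hard reduce L' (_ , N , time , constsN , decides)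
      with reduce (Accepts N) N time (λ _ _ → id , id)
    ... | M' , (c , k , bound) , nonArith , consts' , correct =
      M' , constsX , nonArith , (c , k , λ xs _ → bound xs _) , correctX
      where
      constsX : ConstantsIn M' X
      constsX a mc = [ constsN a , Const01⇒X x0 x1 a ]′ (consts' a mc)

      correctX : ∀ xs → All X xs → ∀ w → Halts M' (initConfig M' xs []) w →
                 (L' xs → P w × All X w) × (P w × All X w → L' xs)
      correctX xs xsX w halts =
        (λ l → proj₁ (correct xs w halts) (proj₁ (decides xs xsX) l) ,
               nonArithmetic-Halts-in x0 x1 constsX nonArith xsX halts) ,
        proj₂ (decides xs xsX) ∘ proj₂ (correct xs w halts) ∘ proj₁

mainTheorem8 : (S : PosSemiring) (T : BranchMode S) (X : PosSemiring.K S → Set) →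
    X (PosSemiring.0# S) → X (PosSemiring.1# S) →
    (P : List (PosSemiring.K S) → Set) →
    BSS.NP-K-CompleteRespConst S T P →
    BSS.NP-KX-CompleteNonArith S T X (λ xs → P xs × All X xs)
mainTheorem8 S T X x0 x1 P (decider , reduce) =
  restriction-in-NP-KX S T X x0 x1 decider , restriction-NP-KX-hard S T X x0 x1 reduce
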